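{- Let $n,k\in\mathbb{N}$ and $N=n+k$. Let $Q=\mathcal{Q}([N])$ be colored blue/red with no blue copy of $\Lambda$. Then there is no red copy of $Q_n$ in $Q$ if and only if for every $\mathcal{Y}\in\binom{[N]}{k}$ there exists a blue $\mathcal{Y}$-shrub in $Q$.
   Context: $[N]=\{1,\dots,N\}$; $\binom{[N]}{k}$ is the set of $k$-element subsets of $[N]$. $\mathcal{Q}(\mathcal{S})$ is the Boolean lattice of all subsets of $\mathcal{S}$ ordered by inclusion and $Q_n$ is a Boolean lattice on an $n$-element ground set. A copy of a poset is a subset isomorphic to it with the inherited order; a red/blue copy has all elements red/blue. $\Lambda$ is the poset on $Z_1,Z_2,Z_3$ with $Z_1<Z_3$, $Z_2<Z_3$, $Z_1,Z_2$ incomparable. An ordered subset of $\mathcal{Y}$ is a (possibly empty) subset with a linear order; $\underline{S}$ is its underlying set; $T\le_{\mathcal{O}}S$ means $T$ is a prefix of $S$. The factorial tree $\mathcal{O}(\mathcal{Y})$ is the poset of ordered subsets of $\mathcal{Y}$ under $\le_{\mathcal{O}}$. A $\mathcal{Y}$-shrub in $Q$ is the image of a poset embedding (injective, order-preserving and order-reflecting) $\tau:\mathcal{O}(\mathcal{Y})\to Q$ with $\tau(S)\cap\mathcal{Y}=\underline{S}$ for all $S$. -}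

module Defs where

open import Level using (Level)
open import Data.Nat using (ℕ; _+_)
open import Data.Fin using (Fin)
open import Data.Fin.Subset using (Subset; _⊆_; _∈_; _∩_; _∪_; ⁅_⁆; ⊥)
open import Data.List using (List; foldr)
open import Data.List.Relation.Unary.All using (All)
open import Data.List.Relation.Unary.Unique.Propositional using (Unique)
open import Data.List.Relation.Binary.Prefix.Heterogeneous using (Prefix)
open import Data.Product using (Σ; ∃; _×_; proj₁)
open import Relation.Binary.PropositionalEquality using (_≡_)
open import Function.Bundles using (_⇔_)

data Colour : Set where
  red blue : Colour

Colouring : ℕ → Set
Colouring N = Subset N → Colour

record Embedding {a ℓ : Level} (A : Set a) (_≤A_ : A → A → Set ℓ) (N : ℕ) : Set (a Level.⊔ ℓ) where
  field
    map       : A → Subset N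
    injective : ∀ x y → map x ≡ map y → x ≡ y
    preserves : ∀ x y → x ≤A y → map x ⊆ map y
    reflects  : ∀ x y → map x ⊆ map y → x ≤A y

data ΛElt : Set where
  Z₁ Z₂ Z₃ : ΛElt

data _≤Λ_ : ΛElt → ΛElt → Set where
  refl≤ : ∀ {z} → z ≤Λ z
  Z₁≤Z₃ : Z₁ ≤Λ Z₃
  Z₂≤Z₃ : Z₂ ≤Λ Z₃

BlueΛCopy : ∀ {N} → Colouring N → Set
BlueΛCopy {N} c = Σ (Embedding ΛElt _≤Λ_ N) λ e → ∀ z → c (Embedding.map e z) ≡ blue

RedQnCopy : ∀ {N} → ℕ → Colouring N → Set
RedQnCopy {N} n c = Σ (Embedding (Subset n) _⊆_ N) λ e → ∀ X → c (Embedding.map e X) ≡ red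

-- Ordered subsets of 𝒴 ⊆ [N]: duplicate-free lists of elements of 𝒴
-- (the list order is the linear order)
OrderedSubset : ∀ {N} → Subset N → Set
OrderedSubset {N} Y = Σ (List (Fin N)) λ l → Unique l × All (_∈ Y) l

underlying : ∀ {N} → List (Fin N) → Subset N
underlying = foldr (λ x s → ⁅ x ⁆ ∪ s) ⊥

_≤𝒪_ : ∀ {N} {Y : Subset N} → OrderedSubset Y → OrderedSubset Y → Set
S ≤𝒪 T = Prefix _≡_ (proj₁ S) (proj₁ T)

-- A 𝒴-shrub: image of an embedding τ : 𝒪(𝒴) → Q([N]) with τ(S) ∩ 𝒴 = underlying S.
-- (Injectivity is stated on the underlying lists.)
record Shrub {N : ℕ} (Y : Subset N) : Set where
  field
    τ         : OrderedSubset Y → Subset N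
    injective : ∀ S T → τ S ≡ τ T → proj₁ S ≡ proj₁ T
    preserves : ∀ S T → S ≤𝒪 T → τ S ⊆ τ T
    reflects  : ∀ S T → τ S ⊆ τ T → S ≤𝒪 T
    trace     : ∀ S → τ S ∩ Y ≡ underlying (proj₁ S)

BlueShrub : ∀ {N} → Colouring N → Subset N → Set
BlueShrub c Y = Σ (Shrub Y) λ s → ∀ S → c (Shrub.τ s S) ≡ blue

-- Shrubs exclude a red Q_n: if φ is a red copy of Q_n, choose xᵢ ∈ φ{i} ∖ φ(∁{i}), so that
-- xᵢ ∈ φ(A) exactly when i ∈ A, and let Y be the complement of {x₁, …, xₙ}. Along a blue
-- Y-shrub τ keep an ordered set S with S ⊆ φ(A_S), where A_S = {i | xᵢ ∈ τ(S)}. Then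
-- τ(S) ⊆ φ(A_S), and the colours force some z ∈ φ(A_S) ∖ τ(S); z lies in Y, and S can be
-- extended by z. The ordered sets would grow forever.
--
-- Without a red Q_n there is a blue shrub: embed Q(∁ Y) ≅ Q_n by ι and argue by induction
-- on U ⊆ Y, from the largest sets down. For every L, either a blue shrub above U can be rooted at some ι A ∪ U with
-- A ⊇ L, or there is a monotone g into Y making all ι A ∪ U ∪ g(A), A ⊇ L, red. In the
-- second case g is glued from the red families of the children at the minimal blue A₀;
-- where two minimal blue sets lie below A, g(A) = Y and ι A ∪ U ∪ Y is red by Λ-freeness.
-- For U = L = ∅ this yields the shrub or a red copy of Q_n.

module Submission where

open import Defs
open import Data.Nat using (ℕ; zero; suc; _+_; _∸_)
open import Data.Nat.Properties using (m+n∸m≡n; m+n∸n≡m)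
open import Data.Bool.Properties using () renaming (_≟_ to _≟ᵇ_)
open import Data.Fin using (Fin; zero; suc)
open import Data.Fin.Properties using (any?; suc-injective) renaming (_≟_ to _≟ᶠ_)
open import Data.Fin.Subset
  using (Subset; _⊆_; _⊈_; _⊂_; _⊃_; _∈_; _∉_; _∩_; _∪_; ⁅_⁆; ∁; ∣_∣; inside; outside)
  renaming (⊥ to ∅)
open import Data.Fin.Subset.Properties
open import Data.Fin.Subset.Induction using (Acc; acc; ⊂-wellFounded; ⊃-wellFounded)
open import Data.Vec using ([]; _∷_; here; there; tabulate)
open import Data.Vec.Properties using (≡-dec; []=⇒lookup; lookup⇒[]=; lookup∘tabulate)
open import Data.List using (List; []; _∷_; _++_; [_])
open import Data.List.Membership.Propositional using () renaming (_∈_ to _∈ₗ_)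
open import Data.List.Membership.Propositional.Properties using (∈-++⁺ˡ; ∈-++⁺ʳ; ∈-++⁻)
open import Data.List.Relation.Unary.All as All using (All; []; _∷_)
open import Data.List.Relation.Unary.All.Properties as All using ()
open import Data.List.Relation.Unary.AllPairs using ([]; _∷_)
open import Data.List.Relation.Unary.Any using (here; there)
open import Data.List.Relation.Unary.Unique.Propositional using (Unique)
open import Data.List.Relation.Unary.Unique.Propositional.Properties as Unique using ()
open import Data.List.Relation.Binary.Pointwise as Pointwise using (Pointwise-≡⇒≡)
open import Data.List.Relation.Binary.Prefix.Heterogeneous
  using (Prefix; []; _∷_; fromView) renaming (_++_ to _++ᵛ_)
open import Data.List.Relation.Binary.Prefix.Heterogeneous.Properties using (antisym)
open import Data.Product using (∃; _×_; _,_; proj₁; proj₂)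
open import Data.Sum as Sum using (_⊎_; inj₁; inj₂; [_,_]′)
open import Data.Unit using (⊤; tt)
open import Data.Empty using (⊥-elim)
open import Function using (_∘_)
open import Function.Bundles using (_⇔_; mk⇔)
open import Function.Definitions using (Injective)
open import Relation.Nullary using (¬_; Dec; yes; no; does)
open import Relation.Nullary.Decidable using (_×-dec_; _→-dec_; ¬?; dec-true; decidable-stable)
open import Relation.Binary.PropositionalEquality
  using (_≡_; _≢_; refl; sym; trans; cong; subst; module ≡-Reasoning)

private
  variable
    m n N : ℕ

∪-mono : {p p′ q q′ : Subset N} → p ⊆ p′ → q ⊆ q′ → p ∪ q ⊆ p′ ∪ q′
∪-mono {p = p} {q = q} p⊆p′ q⊆q′ x∈p∪q with x∈p∪q⁻ p q x∈p∪q
... | inj₁ x∈p = x∈p∪q⁺ (inj₁ (p⊆p′ x∈p))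
... | inj₂ x∈q = x∈p∪q⁺ (inj₂ (q⊆q′ x∈q))

⁅x⁆∪p⊆q : {x : Fin N} {p q : Subset N} → x ∈ q → p ⊆ q → ⁅ x ⁆ ∪ p ⊆ q
⁅x⁆∪p⊆q {x = x} {p} x∈q p⊆q y∈ with x∈p∪q⁻ ⁅ x ⁆ p y∈
... | inj₁ y∈⁅x⁆ = subst (_∈ _) (sym (x∈⁅y⁆⇒x≡y x y∈⁅x⁆)) x∈q
... | inj₂ y∈p   = p⊆q y∈p

x∉p⇒p⊂⁅x⁆∪p : {x : Fin N} {p : Subset N} → x ∉ p → p ⊂ ⁅ x ⁆ ∪ p
x∉p⇒p⊂⁅x⁆∪p {x = x} {p} x∉p = q⊆p∪q ⁅ x ⁆ p , x , x∈p∪q⁺ (inj₁ (x∈⁅x⁆ x)) , x∉p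

∣⁅x⁆∪p∣≡1+∣p∣ : (x : Fin N) {p : Subset N} → x ∉ p → ∣ ⁅ x ⁆ ∪ p ∣ ≡ suc ∣ p ∣
∣⁅x⁆∪p∣≡1+∣p∣ zero    {outside ∷ p} _   = cong (suc ∘ ∣_∣) (∪-identityˡ p)
∣⁅x⁆∪p∣≡1+∣p∣ zero    {inside ∷ p}  x∉p = ⊥-elim (x∉p here)
∣⁅x⁆∪p∣≡1+∣p∣ (suc x) {outside ∷ p} x∉p = ∣⁅x⁆∪p∣≡1+∣p∣ x (x∉p ∘ there)
∣⁅x⁆∪p∣≡1+∣p∣ (suc x) {inside ∷ p}  x∉p = cong suc (∣⁅x⁆∪p∣≡1+∣p∣ x (x∉p ∘ there))

p⊈q⇒∃∉ : {p q : Subset N} → p ⊈ q → ∃ λ x → x ∈ p × x ∉ q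
p⊈q⇒∃∉ {p = p} {q} p⊈q with any? (λ x → x ∈? p ×-dec ¬? (x ∈? q))
... | yes found = found
... | no none   = ⊥-elim (p⊈q λ {x} x∈p → decidable-stable (x ∈? q) λ x∉q → none (x , x∈p , x∉q))

_≟ˢ_ : (p q : Subset N) → Dec (p ≡ q)
_≟ˢ_ = ≡-dec _≟ᵇ_

allSubset? : {P : Subset n → Set} → (∀ A → Dec (P A)) → Dec (∀ A → P A)
allSubset? P? with anySubset? (¬? ∘ P?)
... | yes (A , ¬PA) = no λ all → ¬PA (all A)
... | no ∄¬P        = yes λ A → decidable-stable (P? A) λ ¬PA → ∄¬P (A , ¬PA)

all⊎any-Fin : {P Q : Fin n → Set} → (∀ x → P x ⊎ Q x) → (∀ x → P x) ⊎ ∃ Q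
all⊎any-Fin {zero}  _ = inj₁ λ ()
all⊎any-Fin {suc n} PQ with PQ zero | all⊎any-Fin (PQ ∘ suc)
... | inj₂ q | _            = inj₂ (zero , q)
... | inj₁ _ | inj₂ (x , q) = inj₂ (suc x , q)
... | inj₁ p | inj₁ ps      = inj₁ λ { zero → p ; (suc x) → ps x }

all⊎any-Subset : {P Q : Subset n → Set} → (∀ A → P A ⊎ Q A) → (∀ A → P A) ⊎ ∃ Q
all⊎any-Subset {zero} PQ with PQ []
... | inj₁ p = inj₁ λ { [] → p }
... | inj₂ q = inj₂ ([] , q)
all⊎any-Subset {suc n} PQ
  with all⊎any-Subset (PQ ∘ (inside ∷_)) | all⊎any-Subset (PQ ∘ (outside ∷_))
... | inj₂ (A , q) | _            = inj₂ (inside ∷ A , q)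
... | inj₁ _       | inj₂ (A , q) = inj₂ (outside ∷ A , q)
... | inj₁ pᵢ      | inj₁ pₒ      = inj₁ λ { (inside ∷ A) → pᵢ A ; (outside ∷ A) → pₒ A }

Minimal : (Subset n → Set) → Subset n → Set
Minimal P A = P A × (∀ B → P B → B ⊆ A → B ≡ A)

minimal? : {P : Subset n → Set} → (∀ A → Dec (P A)) → ∀ A → Dec (Minimal P A)
minimal? P? A = P? A ×-dec allSubset? λ B → P? B →-dec (B ⊆? A →-dec (B ≟ˢ A))

minimal-below : {P : Subset n → Set} → (∀ A → Dec (P A)) →
                ∀ {A} → Acc _⊂_ A → P A → ∃ λ A₀ → A₀ ⊆ A × Minimal P A₀
minimal-below P? {A} (acc smaller) PA
  with anySubset? (λ B → P? B ×-dec (B ⊆? A ×-dec ¬? (B ≟ˢ A)))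
... | yes (B , PB , B⊆A , B≢A) =
  let A₀ , A₀⊆B , min = minimal-below P? (smaller (B⊆A , p⊈q⇒∃∉ (B≢A ∘ ⊆-antisym B⊆A))) PB
  in  A₀ , ⊆-trans A₀⊆B B⊆A , min
... | no ∄B = A , ⊆-refl , PA , λ B PB B⊆A →
  decidable-stable (B ≟ˢ A) λ B≢A → ∄B (B , PB , B⊆A , B≢A)

∈-underlying⁺ : {l : List (Fin N)} {x : Fin N} → x ∈ₗ l → x ∈ underlying l
∈-underlying⁺ (here refl) = x∈p∪q⁺ (inj₁ (x∈⁅x⁆ _))
∈-underlying⁺ (there x∈l) = x∈p∪q⁺ (inj₂ (∈-underlying⁺ x∈l))

∈-underlying⁻ : (l : List (Fin N)) {x : Fin N} → x ∈ underlying l → x ∈ₗ l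
∈-underlying⁻ []      x∈ = ⊥-elim (∉⊥ x∈)
∈-underlying⁻ (y ∷ l) x∈ with x∈p∪q⁻ ⁅ y ⁆ (underlying l) x∈
... | inj₁ x∈⁅y⁆ = here (x∈⁅y⁆⇒x≡y y x∈⁅y⁆)
... | inj₂ x∈l   = there (∈-underlying⁻ l x∈l)

image : (Fin n → Fin N) → Subset N
image {zero}  f = ∅
image {suc n} f = ⁅ f zero ⁆ ∪ image (f ∘ suc)

∈-image⁻ : (f : Fin n → Fin N) {x : Fin N} → x ∈ image f → ∃ λ i → f i ≡ x
∈-image⁻ {zero}  f x∈ = ⊥-elim (∉⊥ x∈)
∈-image⁻ {suc n} f x∈ with x∈p∪q⁻ ⁅ f zero ⁆ (image (f ∘ suc)) x∈
... | inj₁ x∈⁅f0⁆ = zero , sym (x∈⁅y⁆⇒x≡y _ x∈⁅f0⁆)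
... | inj₂ x∈rest = let i , fi≡x = ∈-image⁻ (f ∘ suc) x∈rest in suc i , fi≡x

∣image∣≡n : (f : Fin n → Fin N) → Injective _≡_ _≡_ f → ∣ image f ∣ ≡ n
∣image∣≡n {zero}  {N} f _ = ∣⊥∣≡0 N
∣image∣≡n {suc n} f f-inj = trans
  (∣⁅x⁆∪p∣≡1+∣p∣ (f zero) f0∉rest)
  (cong suc (∣image∣≡n (f ∘ suc) (suc-injective ∘ f-inj)))
  where
  f0∉rest : f zero ∉ image (f ∘ suc)
  f0∉rest f0∈ with ∈-image⁻ (f ∘ suc) f0∈
  ... | i , fi≡f0 with f-inj fi≡f0
  ...   | ()

preimage : (Fin n → Fin N) → Subset N → Subset n
preimage f p = tabulate λ i → does (f i ∈? p)

∈-preimage⁺ : (f : Fin n → Fin N) {p : Subset N} {i : Fin n} → f i ∈ p → i ∈ preimage f p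
∈-preimage⁺ f {p} {i} fi∈p =
  lookup⇒[]= i _ (trans (lookup∘tabulate _ i) (dec-true (f i ∈? p) fi∈p))

∈-preimage⁻ : (f : Fin n → Fin N) {p : Subset N} {i : Fin n} → i ∈ preimage f p → f i ∈ p
∈-preimage⁻ f {p} {i} i∈ with f i ∈? p | trans (sym (lookup∘tabulate _ i)) ([]=⇒lookup i∈)
... | yes fi∈p | _  = fi∈p
... | no _     | ()

red≢blue : red ≢ blue
red≢blue ()

_≟ᶜ_ : (a b : Colour) → Dec (a ≡ b)
red  ≟ᶜ red  = yes refl
blue ≟ᶜ blue = yes refl
red  ≟ᶜ blue = no λ ()
blue ≟ᶜ red  = no λ ()

≢blue⇒≡red : {a : Colour} → a ≢ blue → a ≡ red
≢blue⇒≡red {red}  _     = refl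
≢blue⇒≡red {blue} a≢blue = ⊥-elim (a≢blue refl)

⊆-embedding : (f : Subset m → Subset N) →
              (∀ {A B} → A ⊆ B → f A ⊆ f B) → (∀ {A B} → f A ⊆ f B → A ⊆ B) →
              Embedding (Subset m) _⊆_ N
⊆-embedding f mono reflects = record
  { map       = f
  ; injective = λ _ _ fA≡fB →
      ⊆-antisym (reflects (⊆-reflexive fA≡fB)) (reflects (⊆-reflexive (sym fA≡fB)))
  ; preserves = λ _ _ → mono
  ; reflects  = λ _ _ → reflects
  }

≤Λ-antisym : {x y : ΛElt} → x ≤Λ y → y ≤Λ x → x ≡ y
≤Λ-antisym refl≤ _ = refl
≤Λ-antisym Z₁≤Z₃ ()
≤Λ-antisym Z₂≤Z₃ ()

blueΛ : {c : Colouring N} {X₁ X₂ X₃ : Subset N} →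
        c X₁ ≡ blue → c X₂ ≡ blue → c X₃ ≡ blue →
        X₁ ⊆ X₃ → X₂ ⊆ X₃ → X₁ ⊈ X₂ → X₂ ⊈ X₁ → BlueΛCopy c
blueΛ {N} {c} {X₁} {X₂} {X₃} b₁ b₂ b₃ X₁⊆X₃ X₂⊆X₃ X₁⊈X₂ X₂⊈X₁ = embedding , colour
  where
  f : ΛElt → Subset N
  f Z₁ = X₁
  f Z₂ = X₂
  f Z₃ = X₃
  preserves : ∀ x y → x ≤Λ y → f x ⊆ f y
  preserves _ _ refl≤ = ⊆-refl
  preserves _ _ Z₁≤Z₃ = X₁⊆X₃
  preserves _ _ Z₂≤Z₃ = X₂⊆X₃
  reflects : ∀ x y → f x ⊆ f y → x ≤Λ y
  reflects Z₁ Z₁ _ = refl≤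
  reflects Z₂ Z₂ _ = refl≤
  reflects Z₃ Z₃ _ = refl≤
  reflects Z₁ Z₃ _ = Z₁≤Z₃
  reflects Z₂ Z₃ _ = Z₂≤Z₃
  reflects Z₁ Z₂ s = ⊥-elim (X₁⊈X₂ s)
  reflects Z₂ Z₁ s = ⊥-elim (X₂⊈X₁ s)
  reflects Z₃ Z₁ s = ⊥-elim (X₂⊈X₁ (⊆-trans X₂⊆X₃ s))
  reflects Z₃ Z₂ s = ⊥-elim (X₁⊈X₂ (⊆-trans X₁⊆X₃ s))
  embedding : Embedding ΛElt _≤Λ_ N
  embedding = record
    { map       = f
    ; injective = λ x y fx≡fy →
        ≤Λ-antisym (reflects x y (⊆-reflexive fx≡fy)) (reflects y x (⊆-reflexive (sym fx≡fy)))
    ; preserves = preserves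
    ; reflects  = reflects
    }
  colour : ∀ z → c (f z) ≡ blue
  colour Z₁ = b₁
  colour Z₂ = b₂
  colour Z₃ = b₃

-- A red copy of Q_n excludes a blue shrub

module Coordinates (φ : Embedding (Subset n) _⊆_ N) where
  open Embedding φ

  separating : ∀ i → ∃ λ x → x ∈ map ⁅ i ⁆ × x ∉ map (∁ ⁅ i ⁆)
  separating i = p⊈q⇒∃∉ λ ⊆map∁ → x∈∁p⇒x∉p (reflects _ _ ⊆map∁ (x∈⁅x⁆ i)) (x∈⁅x⁆ i)

  coordinate : Fin n → Fin N
  coordinate i = proj₁ (separating i)

  coordinate-∈⁺ : ∀ {i A} → i ∈ A → coordinate i ∈ map A
  coordinate-∈⁺ {i} i∈A = preserves _ _ ⁅i⁆⊆A (proj₁ (proj₂ (separating i)))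
    where
    ⁅i⁆⊆A : ⁅ i ⁆ ⊆ _
    ⁅i⁆⊆A j∈⁅i⁆ = subst (_∈ _) (sym (x∈⁅y⁆⇒x≡y i j∈⁅i⁆)) i∈A

  coordinate-∈⁻ : ∀ {i A} → coordinate i ∈ map A → i ∈ A
  coordinate-∈⁻ {i} {A} c∈A = decidable-stable (i ∈? A) λ i∉A →
    proj₂ (proj₂ (separating i)) (preserves _ _ (A⊆∁⁅i⁆ i∉A) c∈A)
    where
    A⊆∁⁅i⁆ : i ∉ A → A ⊆ ∁ ⁅ i ⁆
    A⊆∁⁅i⁆ i∉A j∈A = x∉p⇒x∈∁p λ j∈⁅i⁆ → i∉A (subst (_∈ A) (x∈⁅y⁆⇒x≡y i j∈⁅i⁆) j∈A)

  coordinate-injective : Injective _≡_ _≡_ coordinate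
  coordinate-injective {i} {j} ci≡cj =
    sym (x∈⁅y⁆⇒x≡y i (coordinate-∈⁻ (subst (_∈ map ⁅ i ⁆) ci≡cj (coordinate-∈⁺ (x∈⁅x⁆ i)))))

  coordinates : Subset N
  coordinates = image coordinate

  ∣coordinates∣≡n : ∣ coordinates ∣ ≡ n
  ∣coordinates∣≡n = ∣image∣≡n coordinate coordinate-injective

module RedCopyVersusShrub {c : Colouring N} (φ : Embedding (Subset n) _⊆_ N)
  (φ-red : ∀ A → c (Embedding.map φ A) ≡ red) where
  open Embedding φ
  open Coordinates φ

  Y : Subset N
  Y = ∁ coordinates

  module _ (shrub : Shrub Y) (shrub-blue : ∀ S → c (Shrub.τ shrub S) ≡ blue) where
    open Shrub shrub using (τ; trace) renaming (preserves to τ-mono)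

    support : OrderedSubset Y → Subset n
    support S = preimage coordinate (τ S)

    Covered : OrderedSubset Y → Set
    Covered S = underlying (proj₁ S) ⊆ map (support S)

    underlying⊆τ : ∀ S → underlying (proj₁ S) ⊆ τ S
    underlying⊆τ S x∈ = proj₁ (x∈p∩q⁻ (τ S) Y (subst (_ ∈_) (sym (trace S)) x∈))

    support-mono : ∀ S T → S ≤𝒪 T → support S ⊆ support T
    support-mono S T S≤T i∈ = ∈-preimage⁺ coordinate (τ-mono S T S≤T (∈-preimage⁻ coordinate i∈))

    τ⇒map-support : ∀ S {x} → x ∈ coordinates → x ∈ τ S → x ∈ map (support S)
    τ⇒map-support S x∈X x∈τ with ∈-image⁻ coordinate x∈X
    ... | _ , refl = coordinate-∈⁺ (∈-preimage⁺ coordinate x∈τ)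

    map-support⇒τ : ∀ S {x} → x ∈ coordinates → x ∈ map (support S) → x ∈ τ S
    map-support⇒τ S x∈X x∈map with ∈-image⁻ coordinate x∈X
    ... | _ , refl = ∈-preimage⁻ coordinate (coordinate-∈⁻ x∈map)

    τ⊆map-support : ∀ S → Covered S → τ S ⊆ map (support S)
    τ⊆map-support S covered {x} x∈τ with x ∈? coordinates
    ... | yes x∈X = τ⇒map-support S x∈X x∈τ
    ... | no  x∉X = covered (subst (x ∈_) (trace S) (x∈p∩q⁺ (x∈τ , x∉p⇒x∈∁p x∉X)))

    map-support⊈τ : ∀ S → Covered S → map (support S) ⊈ τ S
    map-support⊈τ S covered map⊆τ = red≢blue (trans (sym (φ-red _))
      (trans (cong c (⊆-antisym map⊆τ (τ⊆map-support S covered))) (shrub-blue S)))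

    escape : ∀ S → Covered S → ∃ λ z → z ∈ Y × z ∉ τ S × z ∈ map (support S)
    escape S covered with p⊈q⇒∃∉ (map-support⊈τ S covered)
    ... | z , z∈map , z∉τ = z , x∉p⇒x∈∁p (λ z∈X → z∉τ (map-support⇒τ S z∈X z∈map)) , z∉τ , z∈map

    snoc : (S : OrderedSubset Y) {z : Fin N} → z ∈ Y → z ∉ underlying (proj₁ S) → OrderedSubset Y
    snoc (l , unique , l⊆Y) {z} z∈Y z∉l =
      l ++ [ z ] ,
      Unique.++⁺ unique ([] ∷ []) (λ { (z∈l , here refl) → z∉l (∈-underlying⁺ z∈l) }) ,
      All.++⁺ l⊆Y (z∈Y ∷ [])

    grow : ∀ S → Covered S → ∃ λ T → Covered T × underlying (proj₁ S) ⊂ underlying (proj₁ T)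
    grow S@(l , _) covered with escape S covered
    ... | z , z∈Y , z∉τ , z∈map = T , T-covered , l⊂l++[z]
      where
      z∉l : z ∉ underlying l
      z∉l = z∉τ ∘ underlying⊆τ S
      T : OrderedSubset Y
      T = snoc S z∈Y z∉l
      map-grows : map (support S) ⊆ map (support T)
      map-grows = preserves _ _ (support-mono S T (fromView (Pointwise.refl refl ++ᵛ [ z ])))
      T-covered : Covered T
      T-covered x∈ with ∈-++⁻ l (∈-underlying⁻ (l ++ [ z ]) x∈)
      ... | inj₁ x∈l        = map-grows (covered (∈-underlying⁺ x∈l))
      ... | inj₂ (here refl) = map-grows z∈map
      l⊂l++[z] : underlying l ⊂ underlying (l ++ [ z ])
      l⊂l++[z] = (λ x∈ → ∈-underlying⁺ (∈-++⁺ˡ (∈-underlying⁻ l x∈))) ,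
                 z , ∈-underlying⁺ (∈-++⁺ʳ l (here refl)) , z∉l

    never-covered : ∀ S → Acc _⊃_ (underlying (proj₁ S)) → ¬ Covered S
    never-covered S (acc larger) covered =
      let T , T-covered , S⊂T = grow S covered in never-covered T (larger S⊂T) T-covered

  no-blue-shrub : ¬ BlueShrub c Y
  no-blue-shrub (shrub , shrub-blue) =
    never-covered shrub shrub-blue ([] , [] , []) (⊃-wellFounded ∅) (λ x∈∅ → ⊥-elim (∉⊥ x∈∅))

-- Without a red copy of Q_m the blue shrub can be built

module ShrubConstruction {c : Colouring N} (no-blueΛ : ¬ BlueΛCopy c) (Y : Subset N)
  (ι : Subset m → Subset N)
  (ι-mono : ∀ {A B} → A ⊆ B → ι A ⊆ ι B) (ι-reflects : ∀ {A B} → ι A ⊆ ι B → A ⊆ B)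
  (ι-avoids : ∀ {A x} → x ∈ ι A → x ∉ Y) where

  ι∪-reflects : {A B : Subset m} {P Q : Subset N} → Q ⊆ Y → ι A ∪ P ⊆ ι B ∪ Q → A ⊆ B
  ι∪-reflects {A} {B} {P} {Q} Q⊆Y ⊆ι∪Q = ι-reflects λ {x} x∈ιA →
    [ (λ x∈ιB → x∈ιB) , (λ x∈Q → ⊥-elim (ι-avoids x∈ιA (Q⊆Y x∈Q))) ]′
      (x∈p∪q⁻ (ι B) Q (⊆ι∪Q (x∈p∪q⁺ (inj₁ x∈ιA))))

  Fresh : Subset N → Fin N → Set
  Fresh U y = y ∈ Y × y ∉ U

  fresh? : ∀ U y → Dec (Fresh U y)
  fresh? U y = y ∈? Y ×-dec ¬? (y ∈? U)

  -- BlueTree U L is the part of a blue shrub above one ordered subset with underlying set U;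
  -- each node is ι A ∪ U′, where U′ is U together with the entries appended so far.
  data BlueTree : Subset N → Subset m → Set where
    node : ∀ {U L} A → L ⊆ A → c (ι A ∪ U) ≡ blue →
           (∀ y → Fresh U y → BlueTree (⁅ y ⁆ ∪ U) A) → BlueTree U L

  -- A red family is a red copy of the interval [L, ⊤] of Q_m lying above U.
  record RedFamily (U : Subset N) (L : Subset m) : Set where
    field
      family      : Subset m → Subset N
      family-mono : ∀ {A B} → L ⊆ A → A ⊆ B → family A ⊆ family B
      family⊆Y    : ∀ A → family A ⊆ Y
      family-red  : ∀ A → L ⊆ A → c (ι A ∪ (U ∪ family A)) ≡ red

  open RedFamily

  redFamily⇒redCopy : RedFamily ∅ ∅ → RedQnCopy m c
  redFamily⇒redCopy F = ⊆-embedding copy copy-mono copy-reflects , copy-red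
    where
    copy : Subset m → Subset N
    copy A = ι A ∪ family F A
    copy-mono : ∀ {A B} → A ⊆ B → copy A ⊆ copy B
    copy-mono A⊆B = ∪-mono (ι-mono A⊆B) (family-mono F (⊆-min _) A⊆B)
    copy-reflects : ∀ {A B} → copy A ⊆ copy B → A ⊆ B
    copy-reflects = ι∪-reflects (family⊆Y F _)
    copy-red : ∀ A → c (copy A) ≡ red
    copy-red A = trans (cong (λ P → c (ι A ∪ P)) (sym (∪-identityˡ _))) (family-red F A (⊆-min A))

  root : {U : Subset N} {L : Subset m} → BlueTree U L → Subset N
  root {U} (node A _ _ _) = ι A ∪ U

  -- The walk stops at the first entry that is not fresh; on the ordered subsets
  -- of Y this never happens.
  τ : {U : Subset N} {L : Subset m} → BlueTree U L → List (Fin N) → Subset N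
  τ t [] = root t
  τ {U} t@(node _ _ _ child) (y ∷ l) with fresh? U y
  ... | yes fresh = τ (child y fresh) l
  ... | no  _     = root t

  FreshList : Subset N → List (Fin N) → Set
  FreshList U []      = ⊤
  FreshList U (y ∷ l) = Fresh U y × FreshList (⁅ y ⁆ ∪ U) l

  τ-blue : {U : Subset N} {L : Subset m} (t : BlueTree U L) (l : List (Fin N)) →
           c (τ t l) ≡ blue
  τ-blue (node _ _ isBlue _) [] = isBlue
  τ-blue {U} (node _ _ isBlue child) (y ∷ l) with fresh? U y
  ... | yes fresh = τ-blue (child y fresh) l
  ... | no  _     = isBlue

  root-above : {U U′ : Subset N} {A : Subset m} (t : BlueTree U′ A) → U ⊆ U′ → ι A ∪ U ⊆ root t
  root-above (node _ A⊆A′ _ _) U⊆U′ = ∪-mono (ι-mono A⊆A′) U⊆U′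

  root⊆τ : {U : Subset N} {L : Subset m} (t : BlueTree U L) (l : List (Fin N)) →
           root t ⊆ τ t l
  root⊆τ t [] = ⊆-refl
  root⊆τ {U} (node A _ _ child) (y ∷ l) with fresh? U y
  ... | yes fresh = ⊆-trans (root-above (child y fresh) (q⊆p∪q ⁅ y ⁆ U)) (root⊆τ (child y fresh) l)
  ... | no  _     = ⊆-refl

  τ-mono : {U : Subset N} {L : Subset m} (t : BlueTree U L) {l l′ : List (Fin N)} →
           Prefix _≡_ l l′ → τ t l ⊆ τ t l′
  τ-mono t {l′ = l′} [] = root⊆τ t l′
  τ-mono {U} (node _ _ _ child) (_∷_ {a = y} refl l≤l′) with fresh? U y
  ... | yes fresh = τ-mono (child y fresh) l≤l′
  ... | no  _     = ⊆-refl

  ∈τ⁻ : {U : Subset N} {L : Subset m} (t : BlueTree U L) {l : List (Fin N)} → FreshList U l →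
        ∀ {x} → x ∈ τ t l → x ∈ Y → x ∈ U ⊎ x ∈ₗ l
  ∈τ⁻ {U} (node A _ _ _) {[]} _ x∈ x∈Y with x∈p∪q⁻ (ι A) U x∈
  ... | inj₁ x∈ιA = ⊥-elim (ι-avoids x∈ιA x∈Y)
  ... | inj₂ x∈U  = inj₁ x∈U
  ∈τ⁻ {U} (node _ _ _ child) {y ∷ l} (fresh , fresh-l) x∈ x∈Y with fresh? U y
  ... | no ¬fresh = ⊥-elim (¬fresh fresh)
  ... | yes fresh′ with ∈τ⁻ (child y fresh′) fresh-l x∈ x∈Y
  ...   | inj₂ x∈l = inj₂ (there x∈l)
  ...   | inj₁ x∈⁅y⁆∪U =
    [ (λ x∈⁅y⁆ → inj₂ (here (x∈⁅y⁆⇒x≡y y x∈⁅y⁆))) , inj₁ ]′ (x∈p∪q⁻ ⁅ y ⁆ U x∈⁅y⁆∪U)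

  ∈τ⁺ : {U : Subset N} {L : Subset m} (t : BlueTree U L) {l : List (Fin N)} → FreshList U l →
        ∀ {x} → x ∈ U ⊎ x ∈ₗ l → x ∈ τ t l
  ∈τ⁺ (node A _ _ _) {[]} _ (inj₁ x∈U) = x∈p∪q⁺ (inj₂ x∈U)
  ∈τ⁺ {U} (node _ _ _ child) {y ∷ l} (fresh , fresh-l) x∈ with fresh? U y
  ... | no ¬fresh  = ⊥-elim (¬fresh fresh)
  ... | yes fresh′ = ∈τ⁺ (child y fresh′) fresh-l (shift x∈)
    where
    shift : ∀ {x} → x ∈ U ⊎ x ∈ₗ (y ∷ l) → x ∈ ⁅ y ⁆ ∪ U ⊎ x ∈ₗ l
    shift (inj₁ x∈U)         = inj₁ (x∈p∪q⁺ (inj₂ x∈U))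
    shift (inj₂ (here refl)) = inj₁ (x∈p∪q⁺ (inj₁ (x∈⁅x⁆ y)))
    shift (inj₂ (there x∈l)) = inj₂ x∈l

  τ-singleton-⊈ : {U : Subset N} {L : Subset m} (t : BlueTree U L) {s s′ : Fin N} →
                  Fresh U s → Fresh U s′ → s ≢ s′ → τ t [ s ] ⊈ τ t [ s′ ]
  τ-singleton-⊈ t f@(s∈Y , s∉U) f′ s≢s′ ⊆τs′
    with ∈τ⁻ t (f′ , tt) (⊆τs′ (∈τ⁺ t (f , tt) (inj₂ (here refl)))) s∈Y
  ... | inj₁ s∈U        = s∉U s∈U
  ... | inj₂ (here s≡s′) = s≢s′ s≡s′

  -- Two different first steps s, s′ would give a blue Λ below τ t (s′ ∷ l′).
  τ-reflects : {U : Subset N} {L : Subset m} (t : BlueTree U L) {l l′ : List (Fin N)} →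
               FreshList U l → FreshList U l′ → τ t l ⊆ τ t l′ → Prefix _≡_ l l′
  τ-reflects t {[]} _ _ _ = []
  τ-reflects t {s ∷ l} {[]} f@((s∈Y , s∉U) , _) _ ⊆τ[]
    with ∈τ⁻ t tt (⊆τ[] (∈τ⁺ t f (inj₂ (here refl)))) s∈Y
  ... | inj₁ s∈U = ⊥-elim (s∉U s∈U)
  τ-reflects t {s ∷ l} {s′ ∷ l′} f@(fresh , _) f′@(fresh′ , _) ⊆τ with s ≟ᶠ s′
  ... | no s≢s′ = ⊥-elim (no-blueΛ (blueΛ {c = c}
      (τ-blue t [ s ]) (τ-blue t [ s′ ]) (τ-blue t (s′ ∷ l′))
      (⊆-trans (τ-mono t (refl ∷ [])) ⊆τ) (τ-mono t (refl ∷ []))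
      (τ-singleton-⊈ t fresh fresh′ s≢s′) (τ-singleton-⊈ t fresh′ fresh (s≢s′ ∘ sym))))
  τ-reflects {U} (node _ _ _ child) {s ∷ l} {s ∷ l′} (fresh , fresh-l) (_ , fresh-l′) ⊆τ | yes refl
    with fresh? U s
  ... | yes fresh″ = refl ∷ τ-reflects (child s fresh″) fresh-l fresh-l′ ⊆τ
  ... | no ¬fresh  = ⊥-elim (¬fresh fresh)

  freshList : {U : Subset N} {l : List (Fin N)} → Unique l → All (_∈ Y) l →
              (∀ {x} → x ∈ₗ l → x ∉ U) → FreshList U l
  freshList {l = []} _ _ _ = tt
  freshList {U} {y ∷ l} (y∉l ∷ unique) (y∈Y ∷ l⊆Y) l∩U≡∅ =
    (y∈Y , l∩U≡∅ (here refl)) , freshList unique l⊆Y l∩⁅y⁆∪U≡∅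
    where
    l∩⁅y⁆∪U≡∅ : ∀ {x} → x ∈ₗ l → x ∉ ⁅ y ⁆ ∪ U
    l∩⁅y⁆∪U≡∅ x∈l x∈ = [ (λ x∈⁅y⁆ → All.lookup y∉l x∈l (sym (x∈⁅y⁆⇒x≡y y x∈⁅y⁆)))
                       , l∩U≡∅ (there x∈l) ]′ (x∈p∪q⁻ ⁅ y ⁆ U x∈)

  blueTree⇒blueShrub : {L : Subset m} → BlueTree ∅ L → BlueShrub c Y
  blueTree⇒blueShrub t = shrub , λ S → τ-blue t (proj₁ S)
    where
    fresh : (S : OrderedSubset Y) → FreshList ∅ (proj₁ S)
    fresh (_ , unique , l⊆Y) = freshList unique l⊆Y λ _ → ∉⊥
    reflects : ∀ S T → τ t (proj₁ S) ⊆ τ t (proj₁ T) → S ≤𝒪 T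
    reflects S T = τ-reflects t (fresh S) (fresh T)
    trace : ∀ S → τ t (proj₁ S) ∩ Y ≡ underlying (proj₁ S)
    trace S@(l , _ , l⊆Y) = ⊆-antisym
      (λ x∈ → let x∈τ , x∈Y = x∈p∩q⁻ _ Y x∈ in
        [ (λ x∈∅ → ⊥-elim (∉⊥ x∈∅)) , ∈-underlying⁺ ]′ (∈τ⁻ t (fresh S) x∈τ x∈Y))
      (λ x∈ → let x∈l = ∈-underlying⁻ l x∈ in
        x∈p∩q⁺ (∈τ⁺ t (fresh S) (inj₂ x∈l) , All.lookup l⊆Y x∈l))
    shrub : Shrub Y
    shrub = record
      { τ         = τ t ∘ proj₁
      ; injective = λ S T τS≡τT → Pointwise-≡⇒≡ (antisym (λ a≡b _ → a≡b)
          (reflects S T (⊆-reflexive τS≡τT)) (reflects T S (⊆-reflexive (sym τS≡τT))))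
      ; preserves = λ S T → τ-mono t
      ; reflects  = reflects
      ; trace     = trace
      }

  Blocked : Subset N → Subset m → Set
  Blocked U A₀ = c (ι A₀ ∪ U) ≡ red ⊎ ∃ λ y → Fresh U y × RedFamily (⁅ y ⁆ ∪ U) A₀

  -- If no A₀ ⊇ L can be a blue node, the red families found above the minimal
  -- blue A₀ are glued into one red family above U.
  module Glue {U : Subset N} (U⊆Y : U ⊆ Y) {L : Subset m}
    (blocked : ∀ A₀ → L ⊆ A₀ → Blocked U A₀) where

    Blue : Subset m → Set
    Blue A = L ⊆ A × c (ι A ∪ U) ≡ blue

    blue? : ∀ A → Dec (Blue A)
    blue? A = L ⊆? A ×-dec (c (ι A ∪ U) ≟ᶜ blue)

    data Minima (A : Subset m) : Set where
      several : ∀ {A₁ A₂} → A₁ ⊆ A → A₂ ⊆ A → Minimal Blue A₁ → Minimal Blue A₂ → A₁ ≢ A₂ →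
                Minima A
      unique  : ∀ {A₀} → A₀ ⊆ A → Minimal Blue A₀ →
                (∀ {A₁} → A₁ ⊆ A → Minimal Blue A₁ → A₁ ≡ A₀) → Minima A
      none    : (∀ {A₀} → A₀ ⊆ A → ¬ Minimal Blue A₀) → Minima A

    minima : ∀ A → Minima A
    minima A with anySubset? (λ A₀ → A₀ ⊆? A ×-dec minimal? blue? A₀)
    ... | no ∄A₀ = none λ A₀⊆A min → ∄A₀ (_ , A₀⊆A , min)
    ... | yes (A₀ , A₀⊆A , min₀)
      with anySubset? (λ A₁ → A₁ ⊆? A ×-dec (minimal? blue? A₁ ×-dec ¬? (A₁ ≟ˢ A₀)))
    ...   | yes (_ , A₁⊆A , min₁ , A₁≢A₀) = several A₁⊆A A₀⊆A min₁ min₀ A₁≢A₀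
    ...   | no ∄A₁ = unique A₀⊆A min₀ λ {A₁} A₁⊆A min₁ →
      decidable-stable (A₁ ≟ˢ A₀) λ A₁≢A₀ → ∄A₁ (A₁ , A₁⊆A , min₁ , A₁≢A₀)

    Jump : Subset m → Set
    Jump A₀ = ¬ Blue A₀ ⊎ ∃ λ y → Fresh U y × RedFamily (⁅ y ⁆ ∪ U) A₀

    jumpAt : ∀ A₀ → Jump A₀
    jumpAt A₀ with L ⊆? A₀
    ... | no L⊈A₀ = inj₁ (L⊈A₀ ∘ proj₁)
    ... | yes L⊆A₀ with blocked A₀ L⊆A₀
    ...   | inj₁ isRed = inj₁ λ (_ , isBlue) → red≢blue (trans (sym isRed) isBlue)
    ...   | inj₂ found = inj₂ found

    jump : ∀ {A₀} → Jump A₀ → Subset m → Subset N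
    jump (inj₁ _)          A = ∅
    jump (inj₂ (y , _ , F)) A = ⁅ y ⁆ ∪ family F A

    jump-mono : ∀ {A₀ A B} (j : Jump A₀) → A₀ ⊆ A → A ⊆ B → jump j A ⊆ jump j B
    jump-mono (inj₁ _)          _     _   = ⊆-refl
    jump-mono (inj₂ (_ , _ , F)) A₀⊆A A⊆B = ∪-mono ⊆-refl (family-mono F A₀⊆A A⊆B)

    jump⊆Y : ∀ {A₀} (j : Jump A₀) A → jump j A ⊆ Y
    jump⊆Y (inj₁ _)                  _ x∈∅ = ⊥-elim (∉⊥ x∈∅)
    jump⊆Y (inj₂ (_ , (y∈Y , _) , F)) A    = ⁅x⁆∪p⊆q y∈Y (family⊆Y F A)

    extension : ∀ {A} → Minima A → Subset N
    extension     (several _ _ _ _ _)    = Y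
    extension {A} (unique {A₀} _ _ _)    = jump (jumpAt A₀) A
    extension     (none _)               = ∅

    extension-mono : ∀ {A B} → A ⊆ B → (mA : Minima A) (mB : Minima B) →
                     extension mA ⊆ extension mB
    extension-mono _   (none _) _ x∈∅ = ⊥-elim (∉⊥ x∈∅)
    extension-mono _   (several _ _ _ _ _) (several _ _ _ _ _) = ⊆-refl
    extension-mono A⊆B (several A₁⊆A A₂⊆A min₁ min₂ A₁≢A₂) (unique _ _ uniqueB) =
      ⊥-elim (A₁≢A₂ (trans (uniqueB (⊆-trans A₁⊆A A⊆B) min₁)
                           (sym (uniqueB (⊆-trans A₂⊆A A⊆B) min₂))))
    extension-mono A⊆B (several A₁⊆A _ min₁ _ _) (none noneB) =
      ⊥-elim (noneB (⊆-trans A₁⊆A A⊆B) min₁)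
    extension-mono _   (unique {A₀} _ _ _) (several _ _ _ _ _) = jump⊆Y (jumpAt A₀) _
    extension-mono A⊆B (unique {A₀} A₀⊆A min₀ _) (unique _ _ uniqueB)
      with uniqueB (⊆-trans A₀⊆A A⊆B) min₀
    ... | refl = jump-mono (jumpAt A₀) A₀⊆A A⊆B
    extension-mono A⊆B (unique A₀⊆A min₀ _) (none noneB) =
      ⊥-elim (noneB (⊆-trans A₀⊆A A⊆B) min₀)

    extension⊆Y : ∀ {A} (mA : Minima A) → extension mA ⊆ Y
    extension⊆Y (several _ _ _ _ _) = ⊆-refl
    extension⊆Y (unique {A₀} _ _ _) = jump⊆Y (jumpAt A₀) _
    extension⊆Y (none _)            = λ x∈∅ → ⊥-elim (∉⊥ x∈∅)

    incomparable : ∀ {A₁ A₂} → Minimal Blue A₁ → Minimal Blue A₂ → A₁ ≢ A₂ → ι A₁ ∪ U ⊈ ι A₂ ∪ U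
    incomparable (blue₁ , _) (_ , minimal₂) A₁≢A₂ ⊆ι∪U =
      A₁≢A₂ (minimal₂ _ blue₁ (ι∪-reflects U⊆Y ⊆ι∪U))

    ¬blue-below : ∀ {A} → (∀ {A₀} → A₀ ⊆ A → ¬ Minimal Blue A₀) → ¬ Blue A
    ¬blue-below {A} noMinimal blueA =
      let _ , A₀⊆A , min = minimal-below blue? (⊂-wellFounded A) blueA in noMinimal A₀⊆A min

    extension-red : ∀ {A} → L ⊆ A → (mA : Minima A) → c (ι A ∪ (U ∪ extension mA)) ≡ red
    extension-red {A} _ (several A₁⊆A A₂⊆A min₁ min₂ A₁≢A₂) with c (ι A ∪ (U ∪ Y)) ≟ᶜ blue
    ... | no ≢blue = ≢blue⇒≡red ≢blue
    ... | yes isBlue = ⊥-elim (no-blueΛ (blueΛ {c = c}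
          (proj₂ (proj₁ min₁)) (proj₂ (proj₁ min₂)) isBlue
          (∪-mono (ι-mono A₁⊆A) (p⊆p∪q Y)) (∪-mono (ι-mono A₂⊆A) (p⊆p∪q Y))
          (incomparable min₁ min₂ A₁≢A₂) (incomparable min₂ min₁ (A₁≢A₂ ∘ sym))))
    extension-red {A} _ (unique {A₀} A₀⊆A min₀ _) with jumpAt A₀
    ... | inj₁ ¬blue = ⊥-elim (¬blue (proj₁ min₀))
    ... | inj₂ (y , _ , F) =
      trans (cong (λ P → c (ι A ∪ P)) (sym reassociate)) (family-red F A A₀⊆A)
      where
      open ≡-Reasoning
      reassociate : (⁅ y ⁆ ∪ U) ∪ family F A ≡ U ∪ (⁅ y ⁆ ∪ family F A)
      reassociate = begin
        (⁅ y ⁆ ∪ U) ∪ family F A ≡⟨ cong (_∪ family F A) (∪-comm ⁅ y ⁆ U) ⟩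
        (U ∪ ⁅ y ⁆) ∪ family F A ≡⟨ ∪-assoc U ⁅ y ⁆ (family F A) ⟩
        U ∪ (⁅ y ⁆ ∪ family F A) ∎
    extension-red {A} L⊆A (none noMinimal) rewrite ∪-identityʳ U with c (ι A ∪ U) ≟ᶜ blue
    ... | no ≢blue  = ≢blue⇒≡red ≢blue
    ... | yes isBlue = ⊥-elim (¬blue-below noMinimal (L⊆A , isBlue))

    redFamily : RedFamily U L
    redFamily = record
      { family      = λ A → extension (minima A)
      ; family-mono = λ {A} {B} _ A⊆B → extension-mono A⊆B (minima A) (minima B)
      ; family⊆Y    = λ A → extension⊆Y (minima A)
      ; family-red  = λ A L⊆A → extension-red L⊆A (minima A)
      }

  Children : Subset N → Set
  Children U = ∀ y → Fresh U y → ∀ L → BlueTree (⁅ y ⁆ ∪ U) L ⊎ RedFamily (⁅ y ⁆ ∪ U) L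

  subtree⊎redFamily : {U : Subset N} → Children U → ∀ A₀ y →
    (Fresh U y → BlueTree (⁅ y ⁆ ∪ U) A₀) ⊎ (Fresh U y × RedFamily (⁅ y ⁆ ∪ U) A₀)
  subtree⊎redFamily {U} children A₀ y with fresh? U y
  ... | no ¬fresh = inj₁ (⊥-elim ∘ ¬fresh)
  ... | yes fresh = Sum.map (λ t _ → t) (fresh ,_) (children y fresh A₀)

  node⊎blocked : {U : Subset N} → Children U → ∀ L A₀ → (L ⊆ A₀ → Blocked U A₀) ⊎
    (L ⊆ A₀ × c (ι A₀ ∪ U) ≡ blue × ∀ y → Fresh U y → BlueTree (⁅ y ⁆ ∪ U) A₀)
  node⊎blocked {U} children L A₀ with L ⊆? A₀ | c (ι A₀ ∪ U) ≟ᶜ blue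
  ... | no L⊈A₀  | _          = inj₁ (⊥-elim ∘ L⊈A₀)
  ... | yes _    | no ≢blue   = inj₁ λ _ → inj₁ (≢blue⇒≡red ≢blue)
  ... | yes L⊆A₀ | yes isBlue with all⊎any-Fin (subtree⊎redFamily children A₀)
  ...   | inj₁ subtrees = inj₂ (L⊆A₀ , isBlue , subtrees)
  ...   | inj₂ found    = inj₁ λ _ → inj₂ found

  grow : {U : Subset N} → U ⊆ Y → Children U → ∀ L → BlueTree U L ⊎ RedFamily U L
  grow U⊆Y children L with all⊎any-Subset (node⊎blocked children L)
  ... | inj₁ blocked = inj₂ (Glue.redFamily U⊆Y blocked)
  ... | inj₂ (A₀ , L⊆A₀ , isBlue , subtrees) = inj₁ (node A₀ L⊆A₀ isBlue subtrees)

  blueTree⊎redFamily : {U : Subset N} → Acc _⊃_ U → U ⊆ Y → ∀ L → BlueTree U L ⊎ RedFamily U L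
  blueTree⊎redFamily (acc larger) U⊆Y = grow U⊆Y λ y (y∈Y , y∉U) →
    blueTree⊎redFamily (larger (x∉p⇒p⊂⁅x⁆∪p y∉U)) (⁅x⁆∪p⊆q y∈Y U⊆Y)

  blueShrub⊎redCopy : BlueShrub c Y ⊎ RedQnCopy m c
  blueShrub⊎redCopy = Sum.map blueTree⇒blueShrub redFamily⇒redCopy
    (blueTree⊎redFamily (⊃-wellFounded ∅) (λ x∈∅ → ⊥-elim (∉⊥ x∈∅)) ∅)

-- The copy of Q(∁ Y) on the positions outside Y

scatter : (Y : Subset N) → Subset ∣ ∁ Y ∣ → Subset N
scatter []            A       = []
scatter (inside ∷ Y)  A       = outside ∷ scatter Y A
scatter (outside ∷ Y) (b ∷ A) = b ∷ scatter Y A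

scatter-mono : (Y : Subset N) {A B : Subset ∣ ∁ Y ∣} → A ⊆ B → scatter Y A ⊆ scatter Y B
scatter-mono (inside ∷ Y)  A⊆B (there x∈) = there (scatter-mono Y A⊆B x∈)
scatter-mono (outside ∷ Y) {_ ∷ _} {_ ∷ _} A⊆B here with A⊆B here
... | here = here
scatter-mono (outside ∷ Y) {_ ∷ _} {_ ∷ _} A⊆B (there x∈) = there (scatter-mono Y (drop-∷-⊆ A⊆B) x∈)

scatter-reflects : (Y : Subset N) {A B : Subset ∣ ∁ Y ∣} → scatter Y A ⊆ scatter Y B → A ⊆ B
scatter-reflects (inside ∷ Y) ⊆scatter = scatter-reflects Y (drop-there ∘ ⊆scatter ∘ there)
scatter-reflects (outside ∷ Y) {_ ∷ _} {_ ∷ _} ⊆scatter here with ⊆scatter here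
... | here = here
scatter-reflects (outside ∷ Y) {_ ∷ _} {_ ∷ _} ⊆scatter (there x∈) =
  there (scatter-reflects Y (drop-there ∘ ⊆scatter ∘ there) x∈)

scatter-avoids : (Y : Subset N) {A : Subset ∣ ∁ Y ∣} {x : Fin N} → x ∈ scatter Y A → x ∉ Y
scatter-avoids (inside ∷ Y)            (there x∈) (there x∈Y) = scatter-avoids Y x∈ x∈Y
scatter-avoids (outside ∷ Y) {_ ∷ _}  (there x∈) (there x∈Y) = scatter-avoids Y x∈ x∈Y

∣p∣≡n⇒∣∁p∣≡m : (p : Subset (n + m)) → ∣ p ∣ ≡ n → ∣ ∁ p ∣ ≡ m
∣p∣≡n⇒∣∁p∣≡m {n} {m} p ∣p∣≡n = trans (∣∁p∣≡n∸∣p∣ p) (trans (cong (n + m ∸_) ∣p∣≡n) (m+n∸m≡n n m))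

∣p∣≡m⇒∣∁p∣≡n : (p : Subset (n + m)) → ∣ p ∣ ≡ m → ∣ ∁ p ∣ ≡ n
∣p∣≡m⇒∣∁p∣≡n {n} {m} p ∣p∣≡m = trans (∣∁p∣≡n∸∣p∣ p) (trans (cong (n + m ∸_) ∣p∣≡m) (m+n∸n≡m n m))

corollary13 : (n k : ℕ) (c : Colouring (n + k)) → ¬ BlueΛCopy c →
    ((¬ RedQnCopy n c) ⇔ ((Y : Subset (n + k)) → ∣ Y ∣ ≡ k → BlueShrub c Y))
corollary13 n k c no-blueΛ = mk⇔ noRedCopy⇒shrubs shrubs⇒noRedCopy
  where
  noRedCopy⇒shrubs : ¬ RedQnCopy n c → (Y : Subset (n + k)) → ∣ Y ∣ ≡ k → BlueShrub c Y
  noRedCopy⇒shrubs noRedCopy Y ∣Y∣≡k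
    with ShrubConstruction.blueShrub⊎redCopy {c = c} no-blueΛ Y
           (scatter Y) (scatter-mono Y) (scatter-reflects Y) (scatter-avoids Y)
  ... | inj₁ shrub   = shrub
  ... | inj₂ redCopy =
    ⊥-elim (noRedCopy (subst (λ m → RedQnCopy m c) (∣p∣≡m⇒∣∁p∣≡n Y ∣Y∣≡k) redCopy))

  shrubs⇒noRedCopy : ((Y : Subset (n + k)) → ∣ Y ∣ ≡ k → BlueShrub c Y) → ¬ RedQnCopy n c
  shrubs⇒noRedCopy shrubs (φ , φ-red) = RedCopyVersusShrub.no-blue-shrub {c = c} φ φ-red
    (shrubs (∁ coordinates) (∣p∣≡n⇒∣∁p∣≡m coordinates ∣coordinates∣≡n))
    where open Coordinates φ
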